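{- Let $[4,01,11]$ be the two-vertex Boolean network $f_1=x_1\leftrightarrow x_2$, $f_2=x_2$. For every delay vector $(\alpha,\beta)$, the MBN built on $[4,01,11]$ admits a limit cycle which is reached from every configuration $(\rho,0)$ with $0\le\rho\le\alpha$.
   Context: The MBN built on a two-vertex Boolean network $(f_1,f_2)$ with delay vector $(\alpha,\beta)$ of positive integers has configurations $(\rho,\gamma)$ with $0\le\rho\le\alpha$, $0\le\gamma\le\beta$, underlying Boolean state $x=([\rho\ge1],[\gamma\ge1])$, and dynamics: the first coordinate becomes $\alpha$ if $f_1(x)=1$, else $\max(\rho-1,0)$; the second becomes $\beta$ if $f_2(x)=1$, else $\max(\gamma-1,0)$. A limit cycle is a periodic orbit of length $\ge2$. $x_1\leftrightarrow x_2$ has value 1 iff $x_1=x_2$. -}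

module Defs where

open import Data.Bool using (Bool; true; false; if_then_else_)
open import Data.Nat using (ℕ; zero; suc; _∸_; _≤_; _<_; _≥_)
open import Data.Product using (_×_; _,_; Σ; ∃; proj₁; proj₂)
open import Relation.Binary.PropositionalEquality using (_≡_; _≢_)

pos : ℕ → Bool
pos zero    = false
pos (suc _) = true

_⇔ᵇ_ : Bool → Bool → Bool
true  ⇔ᵇ true  = true
false ⇔ᵇ false = true
true  ⇔ᵇ false = false
false ⇔ᵇ true  = false

BN₂ : Set
BN₂ = (Bool → Bool → Bool) × (Bool → Bool → Bool)

Config : Set
Config = ℕ × ℕ

ValidConfig : ℕ → ℕ → Config → Set
ValidConfig α β (ρ , γ) = ρ ≤ α × γ ≤ β

state : Config → Bool × Bool
state (ρ , γ) = pos ρ , pos γ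

-- One step of the MBN on (f₁ , f₂) with delay vector (α , β)
-- (max(ρ-1,0) = ρ ∸ 1 on ℕ)
mbnStep : BN₂ → ℕ → ℕ → Config → Config
mbnStep (f₁ , f₂) α β (ρ , γ) =
  (if f₁ (pos ρ) (pos γ) then α else ρ ∸ 1) ,
  (if f₂ (pos ρ) (pos γ) then β else γ ∸ 1)

iterate : {A : Set} → (A → A) → ℕ → A → A
iterate f zero    a = a
iterate f (suc n) a = f (iterate f n a)

IsLimitCycleFrom : (Config → Config) → Config → Set
IsLimitCycleFrom F c =
  Σ ℕ λ p → 2 ≤ p × iterate F p c ≡ c ×
    (∀ k → 1 ≤ k → k < p → iterate F k c ≢ c)

Reaches : (Config → Config) → Config → Config → Set
Reaches F x c = Σ ℕ λ n → Σ ℕ λ k → iterate F n x ≡ iterate F k c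

net-4-01-11 : BN₂
net-4-01-11 = (λ x₁ x₂ → x₁ ⇔ᵇ x₂) , (λ x₁ x₂ → x₂)

{-# OPTIONS --safe #-}
-- With x₂ = 0 the second coordinate stays 0 (f₂ = x₂) and f₁ reduces to ¬ x₁,
-- so the first coordinate is reset to α exactly when it is 0 and otherwise counts
-- down. Hence (0 , 0) → (α , 0) → (α ∸ 1 , 0) → ⋯ → (0 , 0) is a cycle of length
-- α + 1 ≥ 2, and every (ρ , 0) counts down into it.
module Submission where

open import Defs
open import Data.Nat using (ℕ; zero; suc; _∸_; _≤_; _<_; z≤n; s≤s)
open import Data.Nat.Properties using (n∸n≡0; ≤-refl; <⇒≤; m>n⇒m∸n≢0)
open import Data.Product using (_×_; _,_; Σ; proj₁)
open import Relation.Binary.PropositionalEquality using (_≡_; _≢_; refl; sym; trans; cong)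
open Relation.Binary.PropositionalEquality.≡-Reasoning

iterate-suc : {A : Set} (f : A → A) (n : ℕ) (a : A) →
              iterate f (suc n) a ≡ iterate f n (f a)
iterate-suc f zero    a = refl
iterate-suc f (suc n) a = cong f (iterate-suc f n a)

module Net-4-01-11 (α β : ℕ) where

  step : Config → Config
  step = mbnStep net-4-01-11 α β

  iterate-countdown : ∀ k ρ → k ≤ ρ → iterate step k (ρ , 0) ≡ (ρ ∸ k , 0)
  iterate-countdown zero    ρ       _         = refl
  iterate-countdown (suc k) (suc ρ) (s≤s k≤ρ) =
    trans (iterate-suc step k (suc ρ , 0)) (iterate-countdown k ρ k≤ρ)

  countdown-reaches-origin : ∀ ρ → iterate step ρ (ρ , 0) ≡ (0 , 0)
  countdown-reaches-origin ρ = trans (iterate-countdown ρ ρ ≤-refl) (cong (_, 0) (n∸n≡0 ρ))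

  origin-returns : iterate step (suc α) (0 , 0) ≡ (0 , 0)
  origin-returns = begin
    iterate step (suc α) (0 , 0) ≡⟨ iterate-suc step α (0 , 0) ⟩
    iterate step α (α , 0)       ≡⟨ countdown-reaches-origin α ⟩
    (0 , 0)                      ∎

  origin-no-early-return : ∀ k → 1 ≤ k → k < suc α → iterate step k (0 , 0) ≢ (0 , 0)
  origin-no-early-return (suc j) _ (s≤s j<α) returns = m>n⇒m∸n≢0 j<α (cong proj₁ (begin
    (α ∸ j , 0)                  ≡⟨ sym (iterate-countdown j α (<⇒≤ j<α)) ⟩
    iterate step j (α , 0)       ≡⟨ sym (iterate-suc step j (0 , 0)) ⟩
    iterate step (suc j) (0 , 0) ≡⟨ returns ⟩
    (0 , 0)                      ∎))

  origin-isLimitCycle : 1 ≤ α → IsLimitCycleFrom step (0 , 0)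
  origin-isLimitCycle 1≤α = suc α , s≤s 1≤α , origin-returns , origin-no-early-return

proposition17 : (α β : ℕ) → 1 ≤ α → 1 ≤ β →
    Σ Config λ c → ValidConfig α β c ×
    IsLimitCycleFrom (mbnStep net-4-01-11 α β) c ×
    ((ρ : ℕ) → ρ ≤ α → Reaches (mbnStep net-4-01-11 α β) (ρ , 0) c)
proposition17 α β 1≤α _ =
  (0 , 0) , (z≤n , z≤n) , origin-isLimitCycle 1≤α ,
  λ ρ _ → ρ , 0 , countdown-reaches-origin ρ
  where open Net-4-01-11 α β
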